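{- Let $d\ge 2$ and $2\le \ell\le k$ be integers. Let $F$ be an $\ell$-disjoint $(k,d)$-CSP, and call a variable $x$ frequent in $F$ if $\deg(x,F)>\frac{d^k}{e\,d^{\ell-1}k}$. If the number of variables that are frequent in $F$ is at most $\left(\frac{d^k}{e\,d^{\ell-1}k}\right)^{\frac{1}{\ell-1}}$, then $F$ is satisfiable.
   Context: Variables take values in $\{0,1,\dots,d-1\}$. A literal is an expression $x\neq b$ with $x$ a variable and $b\in\{0,\dots,d-1\}$. A $k$-constraint is a set of $k$ literals involving $k$ distinct variables; a $(k,d)$-CSP is a finite set of $k$-constraints. An assignment $\alpha$ satisfies $x\ne b$ if $\alpha(x)\ne b$, satisfies a constraint if it satisfies at least one of its literals, and satisfies a CSP if it satisfies all its constraints. For a constraint $C$, $\mathrm{vbl}(C)$ is the set of variables occurring in $C$ (i.e. $x$ with $x\ne b\in C$ for some $b$); $\deg(x,F)$ is the number of constraints $C\in F$ with $x\in\mathrm{vbl}(C)$. $F$ is $\ell$-disjoint if there are no two distinct constraints $C,D\in F$ with $|\mathrm{vbl}(C)\cap\mathrm{vbl}(D)|\ge\ell$. -}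

module Defs where

open import Data.Nat using (ℕ; zero; suc; _+_; _*_; _^_; _≤_; _<_; _∸_)
open import Data.Nat using (_!)
open import Data.Fin using (Fin)
open import Data.Vec using (Vec; map; lookup)
open import Data.Product using (_×_; _,_; proj₁; proj₂; ∃; Σ-syntax; ∃-syntax)
open import Data.List using (List; length)
open import Data.List.Membership.Propositional using (_∈_)
open import Data.List.Relation.Unary.Unique.Propositional using (Unique)
open import Relation.Binary.PropositionalEquality using (_≡_; _≢_)
open import Data.Vec.Membership.Propositional renaming (_∈_ to _∈ᵥ_)
open import Data.Fin.Properties using (any?)
open import Relation.Nullary using (¬_)
open import Function using (Injective; _⇔_)

-- Euler's number e, via exact rational bounds (no reals in agda-stdlib).
-- S n = Σ_{i=0}^{n} n!/i!, so S n / n! = Σ_{i=0}^{n} 1/i!  (partial sums of e).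
-- Known: S n / n! < e < S n / n! + 1/(n·n!) for n ≥ 1, and both bounds → e.

S : ℕ → ℕ
S zero    = 1
S (suc n) = suc n * S n + 1

_<e·_ : ℕ → ℕ → Set
a <e· b = ∃[ n ] (a * (n !) < S n * b)

-- e · b ≤ a   (for naturals a, b; since e is irrational this equals e·b < a when b > 0)
e·_≤_ : ℕ → ℕ → Set
e· b ≤ a = ∃[ n ] (1 ≤ n × (n * S n + 1) * b ≤ a * (n * (n !)))

-- literal  x ≠ b  is the pair (x , b)
Literal : ℕ → Set
Literal d = ℕ × Fin d

vbl : ∀ {d k} → Vec (Literal d) k → Vec ℕ k
vbl C = map proj₁ C

record Constraint (k d : ℕ) : Set where
  constructor mkC
  field
    lits     : Vec (Literal d) k
    distinct : Injective _≡_ _≡_ (λ i → lookup (vbl lits) i)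
open Constraint public

CSP : ℕ → ℕ → ℕ → Set
CSP k d m = Fin m → Constraint k d

Assignment : ℕ → Set
Assignment d = ℕ → Fin d

SatLit : ∀ {d} → Assignment d → Literal d → Set
SatLit α (x , b) = α x ≢ b

SatC : ∀ {k d} → Assignment d → Constraint k d → Set
SatC α C = ∃[ i ] SatLit α (lookup (lits C) i)

Satisfiable : ∀ {k d m} → CSP k d m → Set
Satisfiable {d = d} F = Σ[ α ∈ Assignment d ] (∀ j → SatC α (F j))

open import Relation.Nullary using (Dec; yes; no)
open import Relation.Unary using (Decidable)
open import Data.Fin using (zero; suc)

countFin : ∀ {n} {P : Fin n → Set} → Decidable P → ℕ
countFin {zero} P? = 0
countFin {suc n} P? with P? zero
... | yes _ = suc (countFin (λ i → P? (suc i)))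
... | no  _ = countFin (λ i → P? (suc i))

open import Data.Vec.Membership.DecPropositional (Data.Nat._≟_) using () renaming (_∈?_ to _∈ᵥ?_)

deg : ∀ {k d m} → ℕ → CSP k d m → ℕ
deg x F = countFin (λ j → x ∈ᵥ? vbl (lits (F j)))

-- |vbl(C) ∩ vbl(D)| (variables in C are distinct, so count positions of C)
common : ∀ {k d} → Constraint k d → Constraint k d → ℕ
common C D = countFin (λ i → lookup (vbl (lits C)) i ∈ᵥ? vbl (lits D))

Disjoint : ∀ {k d m} → ℕ → CSP k d m → Set
Disjoint ℓ F = ∀ i j → i ≢ j → common (F i) (F j) < ℓ

-- x frequent:  deg(x,F) > d^k / (e · d^(ℓ-1) · k),
-- i.e.  d^k < e · (deg(x,F) · d^(ℓ-1) · k)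
Frequent : ∀ {k d m} → ℕ → CSP k d m → ℕ → Set
Frequent {k} {d} ℓ F x = (d ^ k) <e· (deg x F * (d ^ (ℓ ∸ 1)) * k)

-- N ≤ (d^k / (e d^(ℓ-1) k))^(1/(ℓ-1))  ⇔  e · (N^(ℓ-1) · d^(ℓ-1) · k) ≤ d^k   (ℓ ≥ 2)
FewFrequent : ℕ → ℕ → ℕ → ℕ → Set
FewFrequent k d ℓ N = e· (N ^ (ℓ ∸ 1) * d ^ (ℓ ∸ 1) * k) ≤ (d ^ k)

-- Drop from every constraint with fewer than ℓ frequent variables its frequent literals. Each
-- reduced constraint keeps at least k − ℓ + 1 literals, so a uniformly random assignment violates
-- it with probability at most p = d^(ℓ−1) / d^k. A non-frequent variable lies in at most
-- d^k / (e d^(ℓ−1) k) reduced constraints. A frequent variable y lies only in reduced constraints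
-- with at least ℓ frequent variables; choosing ℓ − 1 of them besides y is injective by
-- ℓ-disjointness, so y lies in at most N^(ℓ−1) reduced constraints. With Δ the maximal degree,
-- every reduced constraint shares variables with at most D = kΔ − 1 others, e p (D + 1) ≤ 1, and
-- the symmetric Lovász Local Lemma gives a satisfying assignment. The local lemma is proved by
-- counting the d^|V| assignments of the relevant variables V: by induction on |S|, among the
-- assignments avoiding a set S of constraints at most a 1/(D + 1) fraction violates another one.

module Submission where

open import Defs
open import Data.Nat
  using (ℕ; zero; suc; _+_; _*_; _^_; _∸_; _≤_; _<_; z≤n; s≤s; _!; _≟_; _≤?_; _<?_; >-nonZero)
open import Data.Nat.Properties
open import Data.Nat.Tactic.RingSolver using (solve-∀)
open import Data.Bool using (Bool; true; false; _∧_; not; if_then_else_)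
open import Data.Bool.Properties using (∧-assoc; ∧-conicalˡ; ∧-conicalʳ)
open import Data.Empty using (⊥-elim)
import Data.Fin as Fin
import Data.Fin.Properties as Finₚ
open import Data.Fin using (Fin; zero; suc) renaming (_≟_ to _≟ᶠ_)
open import Data.Bool.ListAction using (all)
open import Data.List
  using (List; []; _∷_; _++_; [_]; map; concat; concatMap; tabulate; length; filter; allFin; take; cartesianProductWith)
open import Data.List.Properties
  using (length-++; length-map; length-take; length-removeAt′; length-filter; map-tabulate; take++drop≡id)
open import Data.List.Membership.Propositional.Properties
  using (∈-filter⁺; ∈-filter⁻; ∈-++⁺ˡ; ∈-++⁺ʳ; ∈-allFin; ∈-cartesianProductWith⁺; ∈-map⁺; ∈-map⁻; ∈-concatMap⁺)
open import Data.List.Extrema.Nat using (argmax; f[xs]≤f[argmax])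
import Data.List.Relation.Unary.Any as Any
open import Data.List.Membership.DecPropositional _≟_ using (_∈?_)
import Data.List.Relation.Unary.Unique.Propositional.Properties as Unique
open import Data.List.Membership.Propositional using (_∈_; _∉_; lose; _─_)
open import Data.List.Relation.Binary.Subset.Propositional using (_⊆_)
import Data.List.Relation.Unary.All as All
open import Data.List.Relation.Unary.All using (All; []; _∷_)
import Data.List.Relation.Unary.All.Properties as All
open import Data.List.Relation.Unary.AllPairs using ([]; _∷_)
open import Data.List.Relation.Unary.Any using (Any; here; there; any?)
open import Data.List.Relation.Unary.Unique.Propositional using (Unique)
open import Data.Product using (_×_; _,_; proj₁; proj₂; ∃-syntax)
open import Data.Vec using (Vec; []; _∷_; lookup; toList)
open import Data.Vec.Membership.Propositional using () renaming (_∈_ to _∈ᵥ_)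
open import Data.Vec.Membership.DecPropositional _≟_ using () renaming (_∈?_ to _∈ᵥ?_)
open import Data.Vec.Properties using (toList-map; length-toList)
import Data.Vec.Relation.Unary.Any.Properties as VecAny
open import Data.Sum using (_⊎_; inj₁; inj₂)
open import Function using (_∘_; id; _⇔_; Equivalence)
open import Relation.Binary.PropositionalEquality
  using (_≡_; _≢_; refl; sym; trans; cong; cong₂; subst; subst₂; module ≡-Reasoning)
open import Relation.Nullary using (¬_; ¬?; Dec; yes; no; does; _×-dec_; _⊎-dec_)
open import Relation.Unary using (Decidable)
open import Relation.Unary.Properties using (∁?)
open import Algebra.Properties.CommutativeSemigroup *-commutativeSemigroup
  using (x∙yz≈y∙xz; xy∙z≈y∙xz; xy∙z≈xz∙y; xy∙z≈yz∙x)
open import Algebra.Properties.CommutativeSemigroup +-commutativeSemigroup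
  using () renaming (interchange to +-interchange)

length-filter+length-filter-∁ : ∀ {A : Set} {P : A → Set} (P? : Decidable P) xs →
                                length (filter P? xs) + length (filter (∁? P?) xs) ≡ length xs
length-filter+length-filter-∁ P? []       = refl
length-filter+length-filter-∁ P? (x ∷ xs) with does (P? x)
... | true  = cong suc (length-filter+length-filter-∁ P? xs)
... | false = trans (+-suc _ _) (cong suc (length-filter+length-filter-∁ P? xs))

map-filter : ∀ {A B : Set} {P : B → Set} (P? : Decidable P) (f : A → B) xs →
             map f (filter (P? ∘ f) xs) ≡ filter P? (map f xs)
map-filter P? f []       = refl
map-filter P? f (x ∷ xs) with does (P? (f x))
... | true  = cong (f x ∷_) (map-filter P? f xs)
... | false = map-filter P? f xs

∈-─ : ∀ {A : Set} {x y : A} {ys} (x∈ys : x ∈ ys) → y ∈ ys → y ≢ x → y ∈ ys ─ x∈ys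
∈-─ (here refl)  (here refl)  y≢x = ⊥-elim (y≢x refl)
∈-─ (here refl)  (there y∈ys) _   = y∈ys
∈-─ (there x∈ys) (here refl)  _   = here refl
∈-─ (there x∈ys) (there y∈ys) y≢x = there (∈-─ x∈ys y∈ys y≢x)

unique-⊆⇒length-≤ : ∀ {A : Set} {xs ys : List A} → Unique xs → xs ⊆ ys → length xs ≤ length ys
unique-⊆⇒length-≤ {xs = []}     _                 _     = z≤n
unique-⊆⇒length-≤ {xs = x ∷ xs} {ys} (x∉xs ∷ xs-unique) x∷xs⊆ys =
  subst (suc (length xs) ≤_) (sym (length-removeAt′ ys _))
        (s≤s (unique-⊆⇒length-≤ xs-unique λ y∈xs →
          ∈-─ x∈ys (x∷xs⊆ys (there y∈xs)) (λ y≡x → All.lookup x∉xs y∈xs (sym y≡x))))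
  where
  x∈ys = x∷xs⊆ys (here refl)

map-unique : ∀ {A B : Set} {f : A → B} {xs} → Unique xs →
             (∀ {a b} → a ∈ xs → b ∈ xs → f a ≡ f b → a ≡ b) → Unique (map f xs)
map-unique []                 _     = []
map-unique (x∉xs ∷ xs-unique) f-inj =
  All.map⁺ (All.tabulate λ z∈xs fx≡fz → All.lookup x∉xs z∈xs (f-inj (here refl) (there z∈xs) fx≡fz))
  ∷ map-unique xs-unique (λ a∈xs b∈xs → f-inj (there a∈xs) (there b∈xs))

∈-take⁻ : ∀ {A : Set} n (xs : List A) {x} → x ∈ take n xs → x ∈ xs
∈-take⁻ n xs x∈ = subst (_ ∈_) (take++drop≡id n xs) (∈-++⁺ˡ x∈)

nonempty⇒∃ : ∀ {A : Set} (xs : List A) → 0 < length xs → ∃[ x ] x ∈ xs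
nonempty⇒∃ (x ∷ xs) _ = x , here refl

length-concatMap-≤ : ∀ {A B : Set} (g : A → List B) xs {b} → (∀ {x} → x ∈ xs → length (g x) ≤ b) →
                     length (concatMap g xs) ≤ length xs * b
length-concatMap-≤ g []       _     = z≤n
length-concatMap-≤ g (x ∷ xs) g≤b =
  ≤-trans (≤-reflexive (length-++ (g x))) (+-mono-≤ (g≤b (here refl)) (length-concatMap-≤ g xs (g≤b ∘ there)))

length-cartesianProductWith : ∀ {A B C : Set} (f : A → B → C) xs ys →
                              length (cartesianProductWith f xs ys) ≡ length xs * length ys
length-cartesianProductWith f []       ys = refl
length-cartesianProductWith f (x ∷ xs) ys =
  trans (length-++ (map (f x) ys)) (cong₂ _+_ (length-map (f x) ys) (length-cartesianProductWith f xs ys))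

tuples : ℕ → List ℕ → List (List ℕ)
tuples zero    xs = [ [] ]
tuples (suc n) xs = cartesianProductWith _∷_ xs (tuples n xs)

length-tuples : ∀ n xs → length (tuples n xs) ≡ length xs ^ n
length-tuples zero    xs = refl
length-tuples (suc n) xs =
  trans (length-cartesianProductWith _∷_ xs (tuples n xs)) (cong (length xs *_) (length-tuples n xs))

∈-tuples : ∀ {xs} t → t ⊆ xs → t ∈ tuples (length t) xs
∈-tuples []      _    = here refl
∈-tuples (z ∷ t) t⊆xs = ∈-cartesianProductWith⁺ _∷_ (t⊆xs (here refl)) (∈-tuples t (t⊆xs ∘ there))

length-filter-tabulate-suc : ∀ {n} {P : Fin (suc n) → Set} (P? : Decidable P) →
                             length (filter (P? ∘ suc) (allFin n)) ≡ length (filter P? (tabulate {n = n} suc))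
length-filter-tabulate-suc {n} P? = begin
  length (filter (P? ∘ suc) (allFin n))            ≡⟨ sym (length-map Fin.suc (filter (P? ∘ suc) (allFin n))) ⟩
  length (map suc (filter (P? ∘ suc) (allFin n)))  ≡⟨ cong length (map-filter P? suc (allFin n)) ⟩
  length (filter P? (map suc (allFin n)))          ≡⟨ cong (length ∘ filter P?) (map-tabulate id suc) ⟩
  length (filter P? (tabulate suc))                ∎
  where open ≡-Reasoning

countFin≡length-filter : ∀ {n} {P : Fin n → Set} (P? : Decidable P) → countFin P? ≡ length (filter P? (allFin n))
countFin≡length-filter {zero}  P? = refl
countFin≡length-filter {suc n} P? with P? zero
... | yes _ = cong suc (trans (countFin≡length-filter (P? ∘ suc)) (length-filter-tabulate-suc P?))
... | no  _ = trans (countFin≡length-filter (P? ∘ suc)) (length-filter-tabulate-suc P?)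

unique-⊆⇒≤countFin : ∀ {n} {P : Fin n → Set} (P? : Decidable P) {L} → Unique L → (∀ {j} → j ∈ L → P j) →
                     length L ≤ countFin P?
unique-⊆⇒≤countFin P? L-unique L⊆P =
  subst (_ ≤_) (sym (countFin≡length-filter P?))
        (unique-⊆⇒length-≤ L-unique (λ j∈L → ∈-filter⁺ P? (∈-allFin _) (L⊆P j∈L)))

countFin-mono : ∀ {n} {P Q : Fin n → Set} (P? : Decidable P) (Q? : Decidable Q) → (∀ {j} → P j → Q j) →
                countFin P? ≤ countFin Q?
countFin-mono {n} P? Q? P⇒Q =
  subst (_≤ countFin Q?) (sym (countFin≡length-filter P?))
        (unique-⊆⇒≤countFin Q? (Unique.filter⁺ P? (Unique.allFin⁺ n)) (P⇒Q ∘ proj₂ ∘ ∈-filter⁻ P? {xs = allFin n}))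

∈-toList⇒lookup : ∀ {A : Set} {n} (v : Vec A n) {x} → x ∈ toList v → ∃[ i ] lookup v i ≡ x
∈-toList⇒lookup (y ∷ v) (here x≡y)  = zero , sym x≡y
∈-toList⇒lookup (y ∷ v) (there x∈v) = let (i , vᵢ≡x) = ∈-toList⇒lookup v x∈v in suc i , vᵢ≡x

toList-unique : ∀ {A : Set} {n} (v : Vec A n) → (∀ {i j} → lookup v i ≡ lookup v j → i ≡ j) → Unique (toList v)
toList-unique []      _          = []
toList-unique (x ∷ v) lookup-inj =
  All.tabulate (λ z∈v x≡z → let (i , vᵢ≡z) = ∈-toList⇒lookup v z∈v in
                             Finₚ.0≢1+n (lookup-inj (trans x≡z (sym vᵢ≡z))))
  ∷ toList-unique v (Finₚ.suc-injective ∘ lookup-inj)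

-- Partial sums of e

sumUpTo : ℕ → (ℕ → ℕ) → ℕ
sumUpTo zero    f = f 0
sumUpTo (suc n) f = f 0 + sumUpTo n (f ∘ suc)

sumUpTo-cong : ∀ n {f g : ℕ → ℕ} → (∀ t → f t ≡ g t) → sumUpTo n f ≡ sumUpTo n g
sumUpTo-cong zero    f≡g = f≡g 0
sumUpTo-cong (suc n) f≡g = cong₂ _+_ (f≡g 0) (sumUpTo-cong n (f≡g ∘ suc))

sumUpTo-mono-≤ : ∀ n {f g : ℕ → ℕ} → (∀ t → f t ≤ g t) → sumUpTo n f ≤ sumUpTo n g
sumUpTo-mono-≤ zero    f≤g = f≤g 0
sumUpTo-mono-≤ (suc n) f≤g = +-mono-≤ (f≤g 0) (sumUpTo-mono-≤ n (f≤g ∘ suc))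

sumUpTo-+ : ∀ n (f g : ℕ → ℕ) → sumUpTo n (λ t → f t + g t) ≡ sumUpTo n f + sumUpTo n g
sumUpTo-+ zero    f g = refl
sumUpTo-+ (suc n) f g = trans (cong (f 0 + g 0 +_) (sumUpTo-+ n (f ∘ suc) (g ∘ suc)))
                              (+-interchange (f 0) (g 0) _ _)

sumUpTo-*ˡ : ∀ n c (f : ℕ → ℕ) → sumUpTo n (λ t → c * f t) ≡ c * sumUpTo n f
sumUpTo-*ˡ zero    c f = refl
sumUpTo-*ˡ (suc n) c f = trans (cong (c * f 0 +_) (sumUpTo-*ˡ n c (f ∘ suc)))
                               (sym (*-distribˡ-+ c (f 0) _))

sumUpTo-*ʳ : ∀ n c (f : ℕ → ℕ) → sumUpTo n (λ t → f t * c) ≡ sumUpTo n f * c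
sumUpTo-*ʳ n c f = trans (sumUpTo-cong n (λ t → *-comm (f t) c))
                         (trans (sumUpTo-*ˡ n c f) (*-comm c _))

sumUpTo-extend : ∀ n (f : ℕ → ℕ) → f (suc n) ≡ 0 → sumUpTo (suc n) f ≡ sumUpTo n f
sumUpTo-extend zero    f f1≡0 = trans (cong (f 0 +_) f1≡0) (+-identityʳ (f 0))
sumUpTo-extend (suc n) f fn≡0 = cong (f 0 +_) (sumUpTo-extend n (f ∘ suc) fn≡0)

choose : ℕ → ℕ → ℕ
choose _       zero    = 1
choose zero    (suc t) = 0
choose (suc n) (suc t) = choose n t + choose n (suc t)

falling : ℕ → ℕ → ℕ
falling _       zero    = 1
falling zero    (suc t) = 0
falling (suc n) (suc t) = suc n * falling n t

choose-above : ∀ n t → n < t → choose n t ≡ 0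
choose-above zero    (suc t) _         = refl
choose-above (suc n) (suc t) (s≤s n<t) =
  cong₂ _+_ (choose-above n t n<t) (choose-above n (suc t) (m≤n⇒m≤1+n n<t))

choose-absorb : ∀ n t → suc t * choose (suc n) (suc t) ≡ suc n * choose n t
choose-absorb zero    zero    = refl
choose-absorb zero    (suc t) = *-zeroʳ (suc (suc t))
choose-absorb (suc n) zero    = cong suc (choose-absorb n zero)
choose-absorb (suc n) (suc t) = begin
  suc (suc t) * (c₁ + c₂)              ≡⟨ split (suc t) c₁ c₂ ⟩
  c₁ + suc t * c₁ + suc (suc t) * c₂   ≡⟨ cong₂ (λ a b → c₁ + a + b) (choose-absorb n t) (choose-absorb n (suc t)) ⟩
  c₁ + suc n * choose n t + suc n * choose n (suc t)
                                       ≡⟨ +-assoc c₁ _ _ ⟩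
  c₁ + (suc n * choose n t + suc n * choose n (suc t))
                                       ≡⟨ cong (c₁ +_) (sym (*-distribˡ-+ (suc n) (choose n t) (choose n (suc t)))) ⟩
  suc (suc n) * c₁                     ∎
  where
  open ≡-Reasoning
  c₁ = choose (suc n) (suc t)
  c₂ = choose (suc n) (suc (suc t))
  split : ∀ s x y → suc s * (x + y) ≡ x + s * x + suc s * y
  split = solve-∀

falling≡choose*! : ∀ n t → falling n t ≡ choose n t * t !
falling≡choose*! n       zero    = refl
falling≡choose*! zero    (suc t) = refl
falling≡choose*! (suc n) (suc t) = begin
  suc n * falling n t                   ≡⟨ cong (suc n *_) (falling≡choose*! n t) ⟩
  suc n * (choose n t * t !)            ≡⟨ sym (*-assoc (suc n) (choose n t) (t !)) ⟩
  suc n * choose n t * t !              ≡⟨ cong (_* t !) (sym (choose-absorb n t)) ⟩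
  suc t * choose (suc n) (suc t) * t !  ≡⟨ xy∙z≈y∙xz (suc t) (choose (suc n) (suc t)) (t !) ⟩
  choose (suc n) (suc t) * (suc t * t !) ∎
  where open ≡-Reasoning

S≡sum-falling : ∀ n → S n ≡ sumUpTo n (falling n)
S≡sum-falling zero    = refl
S≡sum-falling (suc n) = begin
  suc n * S n + 1                          ≡⟨ +-comm _ 1 ⟩
  1 + suc n * S n                          ≡⟨ cong (λ s → 1 + suc n * s) (S≡sum-falling n) ⟩
  1 + suc n * sumUpTo n (falling n)        ≡⟨ cong (1 +_) (sym (sumUpTo-*ˡ n (suc n) (falling n))) ⟩
  1 + sumUpTo n (λ t → suc n * falling n t) ∎
  where open ≡-Reasoning

binomial-theorem : ∀ m n → suc m ^ n ≡ sumUpTo n (λ t → choose n t * m ^ t)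
binomial-theorem m zero    = refl
binomial-theorem m (suc n) = begin
  suc m * suc m ^ n                        ≡⟨ cong (suc m *_) (binomial-theorem m n) ⟩
  sumUpTo n f + m * sumUpTo n f            ≡⟨ cong₂ _+_ (sym (sumUpTo-extend n f f[1+n]≡0))
                                                        (sym (sumUpTo-*ˡ n m f)) ⟩
  1 + sumUpTo n (f ∘ suc) + sumUpTo n (λ t → m * f t)
                                           ≡⟨ cong suc (sym (sumUpTo-+ n (f ∘ suc) (λ t → m * f t))) ⟩
  1 + sumUpTo n (λ t → f (suc t) + m * f t) ≡⟨ cong suc (sumUpTo-cong n pascal) ⟩
  1 + sumUpTo n (λ t → choose (suc n) (suc t) * m ^ suc t) ∎
  where
  open ≡-Reasoning
  f : ℕ → ℕ
  f t = choose n t * m ^ t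
  f[1+n]≡0 : f (suc n) ≡ 0
  f[1+n]≡0 = cong (_* m ^ suc n) (choose-above n (suc n) ≤-refl)
  pascal-identity : ∀ m a b p → b * (m * p) + m * (a * p) ≡ (a + b) * (m * p)
  pascal-identity = solve-∀
  pascal : ∀ t → f (suc t) + m * f t ≡ choose (suc n) (suc t) * m ^ suc t
  pascal t = pascal-identity m (choose n t) (choose n (suc t)) (m ^ t)

n!*m^t≤t!*m^n : ∀ {t n} m → t ≤ n → n ≤ m → n ! * m ^ t ≤ t ! * m ^ n
n!*m^t≤t!*m^n {n = zero}  m z≤n _ = ≤-refl
n!*m^t≤t!*m^n {t} {suc n} m t≤1+n 1+n≤m with m≤n⇒m<n∨m≡n t≤1+n
... | inj₂ refl      = ≤-refl
... | inj₁ (s≤s t≤n) = begin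
  suc n * n ! * m ^ t     ≡⟨ *-assoc (suc n) (n !) (m ^ t) ⟩
  suc n * (n ! * m ^ t)   ≤⟨ *-mono-≤ 1+n≤m (n!*m^t≤t!*m^n m t≤n (≤-trans (n≤1+n n) 1+n≤m)) ⟩
  m * (t ! * m ^ n)       ≡⟨ x∙yz≈y∙xz m (t !) (m ^ n) ⟩
  t ! * (m * m ^ n)       ∎
  where open ≤-Reasoning

choose-term≤falling-term : ∀ {n m} → n ≤ m → ∀ t → choose n t * m ^ t * n ! ≤ falling n t * m ^ n
choose-term≤falling-term {n} {m} n≤m t with n <? t
... | yes n<t rewrite choose-above n t n<t = z≤n
... | no  n≮t = begin
  choose n t * m ^ t * n !      ≡⟨ *-assoc (choose n t) _ _ ⟩
  choose n t * (m ^ t * n !)    ≡⟨ cong (choose n t *_) (*-comm (m ^ t) (n !)) ⟩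
  choose n t * (n ! * m ^ t)    ≤⟨ *-monoʳ-≤ (choose n t) (n!*m^t≤t!*m^n m (≮⇒≥ n≮t) n≤m) ⟩
  choose n t * (t ! * m ^ n)    ≡⟨ sym (*-assoc (choose n t) (t !) (m ^ n)) ⟩
  choose n t * t ! * m ^ n      ≡⟨ cong (_* m ^ n) (sym (falling≡choose*! n t)) ⟩
  falling n t * m ^ n           ∎
  where open ≤-Reasoning

-- (1 + 1/D)^D ≤ S D / D!, comparing the binomial expansion with S D termwise.
[1+D]^D*D!≤S*D^D : ∀ D → suc D ^ D * D ! ≤ S D * D ^ D
[1+D]^D*D!≤S*D^D D = begin
  suc D ^ D * D !                                   ≡⟨ cong (_* D !) (binomial-theorem D D) ⟩
  sumUpTo D (λ t → choose D t * D ^ t) * D !        ≡⟨ sym (sumUpTo-*ʳ D (D !) _) ⟩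
  sumUpTo D (λ t → choose D t * D ^ t * D !)        ≤⟨ sumUpTo-mono-≤ D (choose-term≤falling-term ≤-refl) ⟩
  sumUpTo D (λ t → falling D t * D ^ D)             ≡⟨ sumUpTo-*ʳ D (D ^ D) (falling D) ⟩
  sumUpTo D (falling D) * D ^ D                     ≡⟨ cong (_* D ^ D) (sym (S≡sum-falling D)) ⟩
  S D * D ^ D                                       ∎
  where open ≤-Reasoning

cross-≤-trans : ∀ x y z w t v → 0 < w → x * w ≤ z * y → z * v ≤ t * w → x * v ≤ t * y
cross-≤-trans x y z w t v w>0 xw≤zy zv≤tw =
  *-cancelʳ-≤ (x * v) (t * y) w {{>-nonZero w>0}} (begin
    x * v * w   ≡⟨ xy∙z≈xz∙y x v w ⟩
    x * w * v   ≤⟨ *-monoˡ-≤ v xw≤zy ⟩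
    z * y * v   ≡⟨ xy∙z≈xz∙y z y v ⟩
    z * v * y   ≤⟨ *-monoˡ-≤ y zv≤tw ⟩
    t * w * y   ≡⟨ xy∙z≈xz∙y t w y ⟩
    t * y * w   ∎)
  where open ≤-Reasoning

n*n!>0 : ∀ {n} → 1 ≤ n → 0 < n * n !
n*n!>0 {suc n} _ = *-mono-≤ {1} {suc n} (s≤s z≤n) (1≤n! (suc n))

a*[b*c]+c≡[a*b+1]*c : ∀ a b c → a * (b * c) + c ≡ (a * b + 1) * c
a*[b*c]+c≡[a*b+1]*c = solve-∀

S/!-mono : ∀ {m m'} → m ≤ m' → S m * m' ! ≤ S m' * m !
S/!-mono {m} {zero}   z≤n       = ≤-refl
S/!-mono {m} {suc m'} m≤1+m' with m≤n⇒m<n∨m≡n m≤1+m'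
... | inj₂ refl          = ≤-refl
... | inj₁ (s≤s m≤m') = begin
  S m * (suc m' * m' !)        ≡⟨ x∙yz≈y∙xz (S m) (suc m') (m' !) ⟩
  suc m' * (S m * m' !)        ≤⟨ *-monoʳ-≤ (suc m') (S/!-mono m≤m') ⟩
  suc m' * (S m' * m !)        ≤⟨ m≤m+n _ (m !) ⟩
  suc m' * (S m' * m !) + m !  ≡⟨ a*[b*c]+c≡[a*b+1]*c (suc m') (S m') (m !) ⟩
  (suc m' * S m' + 1) * m !    ∎
  where open ≤-Reasoning

-- (n · S n + 1) / (n · n!) is the upper estimate of e used by e·_≤_; it decreases with n.
e-upper-step : ∀ a → (suc a * S (suc a) + 1) * (a * a !) ≤ (a * S a + 1) * (suc a * (suc a * a !))
e-upper-step a = m+n≤o⇒m≤o _ (≤-reflexive (identity a (S a) (a !)))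
  where
  identity : ∀ a s f → (suc a * (suc a * s + 1) + 1) * (a * f) + f ≡ (a * s + 1) * (suc a * (suc a * f))
  identity = solve-∀

e-upper-antimono : ∀ {n a} → 1 ≤ n → n ≤ a → (a * S a + 1) * (n * n !) ≤ (n * S n + 1) * (a * a !)
e-upper-antimono {a = zero}  ()  z≤n
e-upper-antimono {n} {suc a} 1≤n n≤1+a with m≤n⇒m<n∨m≡n n≤1+a
... | inj₂ refl        = ≤-refl
... | inj₁ (s≤s n≤a) =
  cross-≤-trans (suc a * S (suc a) + 1) (suc a * (suc a * a !)) (a * S a + 1) (a * a !)
                (n * S n + 1) (n * n !)
                (n*n!>0 (≤-trans 1≤n n≤a)) (e-upper-step a) (e-upper-antimono 1≤n n≤a)

S/!≤e-upper : ∀ m {n} → 1 ≤ n → S m * (n * n !) ≤ (n * S n + 1) * m !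
S/!≤e-upper m {n} 1≤n with m ≤? n
... | yes m≤n = begin
  S m * (n * n !)             ≡⟨ x∙yz≈y∙xz (S m) n (n !) ⟩
  n * (S m * n !)             ≤⟨ *-monoʳ-≤ n (S/!-mono m≤n) ⟩
  n * (S n * m !)             ≤⟨ m≤m+n _ (m !) ⟩
  n * (S n * m !) + m !       ≡⟨ a*[b*c]+c≡[a*b+1]*c n (S n) (m !) ⟩
  (n * S n + 1) * m !         ∎
  where open ≤-Reasoning
... | no m≰n = cross-≤-trans (S m) (m !) (m * S m + 1) (m * m !) (n * S n + 1) (n * n !)
                             (n*n!>0 (≤-trans 1≤n n≤m)) S/!≤e-upper-at-m (e-upper-antimono 1≤n n≤m)
  where
  n≤m : n ≤ m
  n≤m = ≤-trans (n≤1+n n) (≰⇒> m≰n)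
  S/!≤e-upper-at-m : S m * (m * m !) ≤ (m * S m + 1) * m !
  S/!≤e-upper-at-m = begin
    S m * (m * m !)   ≡⟨ sym (*-assoc (S m) m (m !)) ⟩
    S m * m * m !     ≡⟨ cong (_* m !) (*-comm (S m) m) ⟩
    m * S m * m !     ≤⟨ *-monoˡ-≤ (m !) (m≤m+n (m * S m) 1) ⟩
    (m * S m + 1) * m ! ∎
    where open ≤-Reasoning

-- b ·e≤ a  encodes  b · e ≤ a  as  b · S n / n! ≤ a  for every partial sum of e.
infix 4 _·e≤_
_·e≤_ : ℕ → ℕ → Set
b ·e≤ a = ∀ n → S n * b ≤ a * n !

≤-·e≤-trans : ∀ {a b b'} → b' ≤ b → b ·e≤ a → b' ·e≤ a
≤-·e≤-trans b'≤b b·e≤a n = ≤-trans (*-monoʳ-≤ (S n) b'≤b) (b·e≤a n)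

≮e·⇒·e≤ : ∀ {a b} → ¬ (a <e· b) → b ·e≤ a
≮e·⇒·e≤ a≮e·b n = ≮⇒≥ (λ a*n!<S*b → a≮e·b (n , a*n!<S*b))

e·≤⇒·e≤ : ∀ {a b} → e· b ≤ a → b ·e≤ a
e·≤⇒·e≤ {a} {b} (n , 1≤n , upper*b≤a*n*n!) m =
  *-cancelʳ-≤ (S m * b) (a * m !) (n * n !) {{>-nonZero (n*n!>0 1≤n)}} (begin
    S m * b * (n * n !)         ≡⟨ xy∙z≈y∙xz (S m) b (n * n !) ⟩
    b * (S m * (n * n !))       ≤⟨ *-monoʳ-≤ b (S/!≤e-upper m 1≤n) ⟩
    b * ((n * S n + 1) * m !)   ≡⟨ sym (*-assoc b _ (m !)) ⟩
    b * (n * S n + 1) * m !     ≡⟨ cong (_* m !) (*-comm b _) ⟩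
    (n * S n + 1) * b * m !     ≤⟨ *-monoˡ-≤ (m !) upper*b≤a*n*n! ⟩
    a * (n * n !) * m !         ≡⟨ xy∙z≈xz∙y a (n * n !) (m !) ⟩
    a * m ! * (n * n !)         ∎)
  where open ≤-Reasoning

·e≤⇒[1+D]^[1+D]*c≤P*D^D : ∀ {P c} D → suc D * c ·e≤ P → suc D ^ suc D * c ≤ P * D ^ D
·e≤⇒[1+D]^[1+D]*c≤P*D^D {P} {c} D [1+D]c·e≤P =
  *-cancelʳ-≤ (suc D ^ suc D * c) (P * D ^ D) (D !) {{D !≢0}} (begin
    suc D * suc D ^ D * c * D !      ≡⟨ rearrange (suc D) (suc D ^ D) c (D !) ⟩
    suc D ^ D * D ! * (suc D * c)    ≤⟨ *-monoˡ-≤ (suc D * c) ([1+D]^D*D!≤S*D^D D) ⟩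
    S D * D ^ D * (suc D * c)        ≡⟨ xy∙z≈xz∙y (S D) (D ^ D) (suc D * c) ⟩
    S D * (suc D * c) * D ^ D        ≤⟨ *-monoˡ-≤ (D ^ D) ([1+D]c·e≤P D) ⟩
    P * D ! * D ^ D                  ≡⟨ xy∙z≈xz∙y P (D !) (D ^ D) ⟩
    P * D ^ D * D !                  ∎)
  where
  open ≤-Reasoning
  rearrange : ∀ a b c f → a * b * c * f ≡ b * f * (a * c)
  rearrange = solve-∀

[1+D]^[1+s]*c≤P*D^s : ∀ {D s c P} → s ≤ D → suc D ^ suc D * c ≤ P * D ^ D → suc D ^ suc s * c ≤ P * D ^ s
[1+D]^[1+s]*c≤P*D^s {D} {s} {c} {P} s≤D lll-condition =
  *-cancelʳ-≤ (suc D ^ suc s * c) (P * D ^ s) (suc D ^ r) {{m^n≢0 (suc D) r}} (begin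
    suc D ^ suc s * c * suc D ^ r   ≡⟨ xy∙z≈xz∙y (suc D ^ suc s) c (suc D ^ r) ⟩
    suc D ^ suc s * suc D ^ r * c   ≡⟨ cong (_* c) (sym (^-distribˡ-+-* (suc D) (suc s) r)) ⟩
    suc D ^ (suc s + r) * c         ≡⟨ cong (λ e → suc D ^ suc e * c) s+r≡D ⟩
    suc D ^ suc D * c               ≤⟨ lll-condition ⟩
    P * D ^ D                       ≡⟨ cong (λ e → P * D ^ e) (sym s+r≡D) ⟩
    P * D ^ (s + r)                 ≡⟨ cong (P *_) (^-distribˡ-+-* D s r) ⟩
    P * (D ^ s * D ^ r)             ≤⟨ *-monoʳ-≤ P (*-monoʳ-≤ (D ^ s) (^-monoˡ-≤ r (n≤1+n D))) ⟩
    P * (D ^ s * suc D ^ r)         ≡⟨ sym (*-assoc P (D ^ s) _) ⟩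
    P * D ^ s * suc D ^ r           ∎)
  where
  open ≤-Reasoning
  r = D ∸ s
  s+r≡D : s + r ≡ D
  s+r≡D = m+[n∸m]≡n s≤D

D*[z+w]≤[1+D]*z : ∀ D z w → suc D * w ≤ z + w → D * (z + w) ≤ suc D * z
D*[z+w]≤[1+D]*z D z w [1+D]w≤z+w = begin
  D * (z + w)       ≡⟨ *-distribˡ-+ D z w ⟩
  D * z + D * w     ≤⟨ +-monoʳ-≤ (D * z) (+-cancelʳ-≤ w (D * w) z (subst (_≤ z + w) (+-comm w (D * w)) [1+D]w≤z+w)) ⟩
  D * z + z         ≡⟨ +-comm (D * z) z ⟩
  suc D * z         ∎
  where open ≤-Reasoning

n<m+n⇒0<m : ∀ {m n} → n < m + n → 0 < m
n<m+n⇒0<m {zero}  n<n = ⊥-elim (<-irrefl refl n<n)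
n<m+n⇒0<m {suc m} _   = s≤s z≤n

[1+D]*w≤z⇒w<z : ∀ {D w z} → 1 ≤ D → 0 < z → suc D * w ≤ z → w < z
[1+D]*w≤z⇒w<z {D} {w} {z} 1≤D z>0 [1+D]w≤z = ≰⇒> λ z≤w → <-irrefl refl (begin-strict
  z             <⟨ m<m+n z z>0 ⟩
  z + z         ≤⟨ +-mono-≤ z≤w z≤w ⟩
  w + w         ≤⟨ +-monoʳ-≤ w (≤-trans (≤-reflexive (sym (*-identityˡ w))) (*-monoˡ-≤ w 1≤D)) ⟩
  w + D * w     ≤⟨ [1+D]w≤z ⟩
  z             ∎)
  where open ≤-Reasoning

w*P≤c*z⇒w<z : ∀ {w z c P} → c < P → 0 < z → w * P ≤ c * z → w < z
w*P≤c*z⇒w<z {w} {z} {c} {P} c<P z>0 wP≤cz = ≰⇒> λ z≤w → <-irrefl refl (begin-strict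
  c * z   <⟨ *-monoˡ-< z {{>-nonZero z>0}} c<P ⟩
  P * z   ≡⟨ *-comm P z ⟩
  z * P   ≤⟨ *-monoˡ-≤ P z≤w ⟩
  w * P   ≤⟨ wP≤cz ⟩
  c * z   ∎)
  where open ≤-Reasoning

D^s>0 : ∀ {D s} → s ≤ D → 0 < D ^ s
D^s>0 {s = zero}    _ = s≤s z≤n
D^s>0 {suc D} {suc s} _ = m^n>0 (suc D) (suc s)

-- In the local lemma w / z is a conditional probability, bounded by (c / P) · ((D + 1) / D) ^ s for s ≤ D.
conditional-bound⇒[1+D]*w≤z : ∀ {D s c P w z} → c < P → s ≤ D → suc D ^ suc D * c ≤ P * D ^ D →
                               w * P * D ^ s ≤ suc D ^ s * c * z → suc D * w ≤ z
conditional-bound⇒[1+D]*w≤z {D} {s} {c} {P} {w} {z} c<P s≤D lll-condition wPD^s≤[1+D]^scz =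
  *-cancelʳ-≤ (suc D * w) z (P * D ^ s) {{>-nonZero (*-mono-≤ (≤-trans (s≤s z≤n) c<P) (D^s>0 s≤D))}} (begin
    suc D * w * (P * D ^ s)         ≡⟨ rearrange (suc D) w P (D ^ s) ⟩
    suc D * (w * P * D ^ s)         ≤⟨ *-monoʳ-≤ (suc D) wPD^s≤[1+D]^scz ⟩
    suc D * (suc D ^ s * c * z)     ≡⟨ sym (*-assoc (suc D) (suc D ^ s * c) z) ⟩
    suc D * (suc D ^ s * c) * z     ≡⟨ cong (_* z) (sym (*-assoc (suc D) (suc D ^ s) c)) ⟩
    suc D ^ suc s * c * z           ≤⟨ *-monoˡ-≤ z ([1+D]^[1+s]*c≤P*D^s {D} {s} {c} {P} s≤D lll-condition) ⟩
    P * D ^ s * z                   ≡⟨ *-comm (P * D ^ s) z ⟩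
    z * (P * D ^ s)                 ∎)
  where
  open ≤-Reasoning
  rearrange : ∀ a b e f → a * b * (e * f) ≡ a * (b * e * f)
  rearrange = solve-∀

conditional-bound⇒w<z : ∀ {D s c P w z} → c < P → 0 < z → s ≤ D → suc D ^ suc D * c ≤ P * D ^ D →
                         w * P * D ^ s ≤ suc D ^ s * c * z → w < z
conditional-bound⇒w<z {zero} {zero} {c} {P} {w} {z} c<P z>0 z≤n _ wP≤cz =
  w*P≤c*z⇒w<z c<P z>0 (subst₂ _≤_ (*-identityʳ (w * P)) (cong (_* z) (*-identityˡ c)) wP≤cz)
conditional-bound⇒w<z {suc D} {s} {c} {P} {w} {z} c<P z>0 s≤D lll-condition wPD^s≤[1+D]^scz =
  [1+D]*w≤z⇒w<z {suc D} (s≤s z≤n) z>0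
    (conditional-bound⇒[1+D]*w≤z {suc D} {s} {c} {P} {w} {z} c<P s≤D lll-condition wPD^s≤[1+D]^scz)

-- Counting assignments

sumFin : ∀ n → (Fin n → ℕ) → ℕ
sumFin zero    f = 0
sumFin (suc n) f = f zero + sumFin n (f ∘ suc)

sumFin-cong : ∀ n {f g : Fin n → ℕ} → (∀ c → f c ≡ g c) → sumFin n f ≡ sumFin n g
sumFin-cong zero    f≡g = refl
sumFin-cong (suc n) f≡g = cong₂ _+_ (f≡g zero) (sumFin-cong n (f≡g ∘ suc))

sumFin-const : ∀ n t → sumFin n (λ _ → t) ≡ n * t
sumFin-const zero    t = refl
sumFin-const (suc n) t = cong (t +_) (sumFin-const n t)

sumFin-*ʳ : ∀ n (f : Fin n → ℕ) k → sumFin n f * k ≡ sumFin n (λ c → f c * k)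
sumFin-*ʳ zero    f k = refl
sumFin-*ʳ (suc n) f k = trans (*-distribʳ-+ k (f zero) _) (cong (f zero * k +_) (sumFin-*ʳ n (f ∘ suc) k))

sumFin-pos : ∀ n {f : Fin n → ℕ} → 1 ≤ n → (∀ c → 0 < f c) → 0 < sumFin n f
sumFin-pos (suc n) {f} _ f>0 = ≤-trans (f>0 zero) (m≤m+n (f zero) _)

module _ {A : Set} where

  count : (A → Bool) → List (A) → ℕ
  count Q []      = 0
  count Q (α ∷ L) = (if Q α then 1 else 0) + count Q L

  count-++ : ∀ Q L M → count Q (L ++ M) ≡ count Q L + count Q M
  count-++ Q []      M = refl
  count-++ Q (α ∷ L) M = trans (cong (_ +_) (count-++ Q L M)) (sym (+-assoc (if Q α then 1 else 0) _ _))

  count-map : ∀ Q f L → count Q (map f L) ≡ count (Q ∘ f) L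
  count-map Q f []      = refl
  count-map Q f (α ∷ L) = cong (_ +_) (count-map Q f L)

  count-cong : ∀ {Q Q'} L → (∀ α → Q α ≡ Q' α) → count Q L ≡ count Q' L
  count-cong []      Q≡Q' = refl
  count-cong (α ∷ L) Q≡Q' = cong₂ (λ b n → (if b then 1 else 0) + n) (Q≡Q' α) (count-cong L Q≡Q')

  count-false : ∀ L → count (λ _ → false) L ≡ 0
  count-false []      = refl
  count-false (α ∷ L) = count-false L

  count-mono : ∀ {Q Q'} L → (∀ α → Q α ≡ true → Q' α ≡ true) → count Q L ≤ count Q' L
  count-mono []      Q⇒Q' = z≤n
  count-mono {Q} {Q'} (α ∷ L) Q⇒Q' with Q α in Qα | Q' α in Q'α
  ... | true  | true  = s≤s (count-mono L Q⇒Q')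
  ... | false | true  = m≤n⇒m≤1+n (count-mono L Q⇒Q')
  ... | false | false = count-mono L Q⇒Q'
  ... | true  | false with () ← trans (sym (Q⇒Q' α Qα)) Q'α

  count-split : ∀ (P Q : A → Bool) L →
                count Q L ≡ count (λ α → not (P α) ∧ Q α) L + count (λ α → P α ∧ Q α) L
  count-split P Q []      = refl
  count-split P Q (α ∷ L) with P α | Q α
  ... | true  | true  = trans (cong suc (count-split P Q L)) (sym (+-suc _ _))
  ... | true  | false = count-split P Q L
  ... | false | true  = cong suc (count-split P Q L)
  ... | false | false = count-split P Q L

  count>0⇒∃ : ∀ Q L → 0 < count Q L → ∃[ α ] Q α ≡ true
  count>0⇒∃ Q (α ∷ L) count>0 with Q α in Qα
  ... | true  = α , Qα
  ... | false = count>0⇒∃ Q L count>0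

  count-concat-tabulate : ∀ Q n (g : Fin n → List A) →
                          count Q (concat (tabulate g)) ≡ sumFin n (count Q ∘ g)
  count-concat-tabulate Q zero    g = refl
  count-concat-tabulate Q (suc n) g =
    trans (count-++ Q (g zero) _) (cong (count Q (g zero) +_) (count-concat-tabulate Q n (g ∘ suc)))

  sumFin-count-select : ∀ {n} (b : Fin n) (Q : A → Bool) L →
                        sumFin n (λ c → count (λ α → does (c ≟ᶠ b) ∧ Q α) L) ≡ count Q L
  sumFin-count-select {suc n} zero    Q L = begin
    count Q L + sumFin n (λ _ → count (λ _ → false) L) ≡⟨ cong (λ t → count Q L + sumFin n (λ _ → t))
                                                               (count-false L) ⟩
    count Q L + sumFin n (λ _ → 0)                     ≡⟨ cong (count Q L +_) (trans (sumFin-const n 0) (*-zeroʳ n)) ⟩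
    count Q L + 0                                      ≡⟨ +-identityʳ _ ⟩
    count Q L                                          ∎
    where open ≡-Reasoning
  sumFin-count-select {suc n} (suc b) Q L =
    trans (cong (_+ sumFin n (λ c → count (λ α → does (c ≟ᶠ b) ∧ Q α) L)) (count-false L))
          (sumFin-count-select b Q L)

module _ {d : ℕ} where

  update : ℕ → Fin d → Assignment d → Assignment d
  update x b α y with y ≟ x
  ... | yes _ = b
  ... | no  _ = α y

  update-same : ∀ x b α → update x b α x ≡ b
  update-same x b α with x ≟ x
  ... | yes _   = refl
  ... | no  x≢x = ⊥-elim (x≢x refl)

  update-other : ∀ x b α {y} → y ≢ x → update x b α y ≡ α y
  update-other x b α {y} y≢x with y ≟ x
  ... | yes y≡x = ⊥-elim (y≢x y≡x)
  ... | no  _   = refl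

  IndependentOf : ℕ → (Assignment d → Bool) → Set
  IndependentOf x Q = ∀ α β → (∀ z → z ≢ x → α z ≡ β z) → Q α ≡ Q β

  independent-update : ∀ {x Q} b α → IndependentOf x Q → Q (update x b α) ≡ Q α
  independent-update {x} b α Q⊥x = Q⊥x _ _ (λ z z≢x → update-other x b α z≢x)

  independent-∘update : ∀ {x Q} y b → y ≢ x → IndependentOf x Q → IndependentOf x (Q ∘ update y b)
  independent-∘update {x} y b y≢x Q⊥x α β α≈β = Q⊥x _ _ agree
    where
    agree : ∀ z → z ≢ x → update y b α z ≡ update y b β z
    agree z z≢x with z ≟ y
    ... | yes _ = refl
    ... | no  _ = α≈β z z≢x

  independent-∧ : ∀ {x P Q} → IndependentOf x P → IndependentOf x Q → IndependentOf x (λ α → P α ∧ Q α)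
  independent-∧ P⊥x Q⊥x α β α≈β = cong₂ _∧_ (P⊥x α β α≈β) (Q⊥x α β α≈β)

  violates : List (Literal d) → Assignment d → Bool
  violates A α = all (λ (x , b) → does (α x ≟ᶠ b)) A

  satisfies : List (Literal d) → Assignment d → Bool
  satisfies A α = not (violates A α)

  vars : List (Literal d) → List ℕ
  vars = map proj₁

  violates-independent : ∀ A {x} → x ∉ vars A → IndependentOf x (violates A)
  violates-independent []            x∉A α β α≈β = refl
  violates-independent ((y , b) ∷ A) x∉A α β α≈β =
    cong₂ (λ u v → does (u ≟ᶠ b) ∧ v) (α≈β y (λ y≡x → x∉A (here (sym y≡x))))
          (violates-independent A (x∉A ∘ there) α β α≈β)

  satisfies⇒∃ : ∀ L (α : Assignment d) → satisfies L α ≡ true → ∃[ lit ] (lit ∈ L × α (proj₁ lit) ≢ proj₂ lit)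
  satisfies⇒∃ []            α ()
  satisfies⇒∃ ((x , b) ∷ L) α sat with α x ≟ᶠ b
  ... | yes _    = let (lit , lit∈L , α≢lit) = satisfies⇒∃ L α sat in lit , there lit∈L , α≢lit
  ... | no  αx≢b = (x , b) , here refl , αx≢b

  satisfies-independent : ∀ A {x} → x ∉ vars A → IndependentOf x (satisfies A)
  satisfies-independent A x∉A α β α≈β = cong not (violates-independent A x∉A α β α≈β)

  module _ (α₀ : Assignment d) where

    -- The d ^ length V assignments that agree with α₀ outside V.
    assignments : List ℕ → List (Assignment d)
    assignments []      = [ α₀ ]
    assignments (x ∷ V) = concat (tabulate λ b → map (update x b) (assignments V))

    count-assignments-∷ : ∀ Q x V →
                          count Q (assignments (x ∷ V)) ≡ sumFin d (λ b → count (Q ∘ update x b) (assignments V))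
    count-assignments-∷ Q x V =
      trans (count-concat-tabulate Q d _) (sumFin-cong d (λ b → count-map Q (update x b) (assignments V)))

    count-all-pos : 1 ≤ d → ∀ V → 0 < count (λ _ → true) (assignments V)
    count-all-pos 1≤d []      = s≤s z≤n
    count-all-pos 1≤d (x ∷ V) = subst (0 <_) (sym (count-assignments-∷ (λ _ → true) x V))
                                      (sumFin-pos d 1≤d (λ _ → count-all-pos 1≤d V))

    count-independent-∷ : ∀ {x Q} V → IndependentOf x Q →
                          count Q (assignments (x ∷ V)) ≡ d * count Q (assignments V)
    count-independent-∷ {x} {Q} V Q⊥x = begin
      count Q (assignments (x ∷ V))
        ≡⟨ count-assignments-∷ Q x V ⟩
      sumFin d (λ b → count (Q ∘ update x b) (assignments V))
        ≡⟨ sumFin-cong d (λ b → count-cong (assignments V) (λ α → independent-update b α Q⊥x)) ⟩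
      sumFin d (λ _ → count Q (assignments V))
        ≡⟨ sumFin-const d _ ⟩
      d * count Q (assignments V) ∎
      where open ≡-Reasoning

    count-fixing-head : ∀ {y} V b Q → IndependentOf y Q →
                        count (λ α → does (α y ≟ᶠ b) ∧ Q α) (assignments (y ∷ V)) ≡ count Q (assignments V)
    count-fixing-head {y} V b Q Q⊥y = begin
      count (λ α → does (α y ≟ᶠ b) ∧ Q α) (assignments (y ∷ V))
        ≡⟨ count-assignments-∷ _ y V ⟩
      sumFin d (λ c → count (λ α → does (update y c α y ≟ᶠ b) ∧ Q (update y c α)) (assignments V))
        ≡⟨ sumFin-cong d (λ c → count-cong (assignments V) λ α →
             cong₂ (λ u v → does (u ≟ᶠ b) ∧ v) (update-same y c α) (independent-update c α Q⊥y)) ⟩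
      sumFin d (λ c → count (λ α → does (c ≟ᶠ b) ∧ Q α) (assignments V))
        ≡⟨ sumFin-count-select b Q (assignments V) ⟩
      count Q (assignments V) ∎
      where open ≡-Reasoning

    count-fixing : ∀ V x b Q → x ∈ V → IndependentOf x Q →
                   count (λ α → does (α x ≟ᶠ b) ∧ Q α) (assignments V) * d ≡ count Q (assignments V)
    count-fixing (y ∷ V) x b Q x∈y∷V Q⊥x with y ≟ x
    ... | yes refl = begin
      count (λ α → does (α y ≟ᶠ b) ∧ Q α) (assignments (y ∷ V)) * d ≡⟨ cong (_* d) (count-fixing-head V b Q Q⊥x) ⟩
      count Q (assignments V) * d                                   ≡⟨ *-comm _ d ⟩
      d * count Q (assignments V)                                   ≡⟨ sym (count-independent-∷ V Q⊥x) ⟩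
      count Q (assignments (y ∷ V))                                 ∎
      where open ≡-Reasoning
    ... | no y≢x = begin
      count (λ α → does (α x ≟ᶠ b) ∧ Q α) (assignments (y ∷ V)) * d
        ≡⟨ cong (_* d) (count-assignments-∷ _ y V) ⟩
      sumFin d (λ c → count (λ α → does (update y c α x ≟ᶠ b) ∧ Q (update y c α)) (assignments V)) * d
        ≡⟨ sumFin-*ʳ d _ d ⟩
      sumFin d (λ c → count (λ α → does (update y c α x ≟ᶠ b) ∧ Q (update y c α)) (assignments V) * d)
        ≡⟨ sumFin-cong d (λ c → cong (_* d) (count-cong (assignments V) λ α →
             cong (λ u → does (u ≟ᶠ b) ∧ Q (update y c α)) (update-other y c α (y≢x ∘ sym)))) ⟩
      sumFin d (λ c → count (λ α → does (α x ≟ᶠ b) ∧ Q (update y c α)) (assignments V) * d)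
        ≡⟨ sumFin-cong d (λ c → count-fixing V x b (Q ∘ update y c) (Any.tail (y≢x ∘ sym) x∈y∷V)
                                              (independent-∘update y c y≢x Q⊥x)) ⟩
      sumFin d (λ c → count (Q ∘ update y c) (assignments V))
        ≡⟨ sym (count-assignments-∷ Q y V) ⟩
      count Q (assignments (y ∷ V)) ∎
      where open ≡-Reasoning

    count-violating : ∀ A V Q → vars A ⊆ V → Unique (vars A) → (∀ {z} → z ∈ vars A → IndependentOf z Q) →
                      count (λ α → violates A α ∧ Q α) (assignments V) * d ^ length A ≡ count Q (assignments V)
    count-violating []            V Q _ _ _ = *-identityʳ _
    count-violating ((x , b) ∷ A) V Q A⊆V (x∉A ∷ A-unique) Q⊥A = begin
      count (λ α → (does (α x ≟ᶠ b) ∧ violates A α) ∧ Q α) (assignments V) * (d * d ^ length A)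
        ≡⟨ cong (_* (d * d ^ length A)) (count-cong (assignments V) (λ α → ∧-assoc (does (α x ≟ᶠ b)) _ _)) ⟩
      count (λ α → does (α x ≟ᶠ b) ∧ (violates A α ∧ Q α)) (assignments V) * (d * d ^ length A)
        ≡⟨ sym (*-assoc (count (λ α → does (α x ≟ᶠ b) ∧ (violates A α ∧ Q α)) (assignments V))
                        d (d ^ length A)) ⟩
      count (λ α → does (α x ≟ᶠ b) ∧ (violates A α ∧ Q α)) (assignments V) * d * d ^ length A
        ≡⟨ cong (_* d ^ length A) (count-fixing V x b _ (A⊆V (here refl))
             (independent-∧ (violates-independent A (All.All¬⇒¬Any x∉A)) (Q⊥A (here refl)))) ⟩
      count (λ α → violates A α ∧ Q α) (assignments V) * d ^ length A
        ≡⟨ count-violating A V Q (A⊆V ∘ there) A-unique (Q⊥A ∘ there) ⟩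
      count Q (assignments V) ∎
      where open ≡-Reasoning

-- The symmetric local lemma, by counting

module LocalLemma {d m : ℕ} (α₀ : Assignment d) (A : Fin m → List (Literal d)) (V : List ℕ) where

  Shares : Fin m → Fin m → Set
  Shares i j = Any (_∈ vars (A j)) (vars (A i))

  shares? : ∀ i → Decidable (Shares i)
  shares? i j = any? (_∈? vars (A j)) (vars (A i))

  avoids : List (Fin m) → Assignment d → Bool
  avoids S α = all (λ j → satisfies (A j) α) S

  avoids-∈ : ∀ {S j} α → j ∈ S → avoids S α ≡ true → satisfies (A j) α ≡ true
  avoids-∈ {k ∷ S} α (here refl)  S-ok = ∧-conicalˡ (satisfies (A k) α) (avoids S α) S-ok
  avoids-∈ {k ∷ S} α (there j∈S) S-ok = avoids-∈ α j∈S (∧-conicalʳ (satisfies (A k) α) (avoids S α) S-ok)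

  avoids-intro : ∀ S α → (∀ {j} → j ∈ S → satisfies (A j) α ≡ true) → avoids S α ≡ true
  avoids-intro []      α _    = refl
  avoids-intro (j ∷ S) α S-ok = cong₂ _∧_ (S-ok (here refl)) (avoids-intro S α (S-ok ∘ there))

  avoids-independent : ∀ S {x} → (∀ {j} → j ∈ S → x ∉ vars (A j)) → IndependentOf x (avoids S)
  avoids-independent []      _   α β α≈β = refl
  avoids-independent (j ∷ S) x∉S α β α≈β =
    cong₂ _∧_ (satisfies-independent (A j) (x∉S (here refl)) α β α≈β)
              (avoids-independent S (x∉S ∘ there) α β α≈β)

  #avoiding : List (Fin m) → ℕ
  #avoiding S = count (avoids S) (assignments α₀ V)

  #violating : Fin m → List (Fin m) → ℕ
  #violating i S = count (λ α → violates (A i) α ∧ avoids S α) (assignments α₀ V)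

  #avoiding-split : ∀ i S → #avoiding S ≡ #avoiding (i ∷ S) + #violating i S
  #avoiding-split i S = count-split (violates (A i)) (avoids S) (assignments α₀ V)

  #avoiding-antimono : ∀ {S S'} → S ⊆ S' → #avoiding S' ≤ #avoiding S
  #avoiding-antimono {S} S⊆S' =
    count-mono (assignments α₀ V) λ α S'-ok → avoids-intro S α (λ j∈S → avoids-∈ α (S⊆S' j∈S) S'-ok)

  #violating-antimono : ∀ i {S S'} → S ⊆ S' → #violating i S' ≤ #violating i S
  #violating-antimono i {S} {S'} S⊆S' = count-mono (assignments α₀ V) λ α ok →
    cong₂ _∧_ (∧-conicalˡ (violates (A i) α) (avoids S' α) ok)
              (avoids-intro S α (λ j∈S → avoids-∈ α (S⊆S' j∈S) (∧-conicalʳ (violates (A i) α) (avoids S' α) ok)))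

  #violating-∈ : ∀ {i S} → i ∈ S → #violating i S ≡ 0
  #violating-∈ {i} {S} i∈S =
    n≤0⇒n≡0 (≤-trans (count-mono (assignments α₀ V) impossible) (≤-reflexive (count-false (assignments α₀ V))))
    where
    impossible : ∀ α → (violates (A i) α ∧ avoids S α) ≡ true → false ≡ true
    impossible α ok = trans (sym (cong not (∧-conicalˡ (violates (A i) α) (avoids S α) ok)))
                            (avoids-∈ α i∈S (∧-conicalʳ (violates (A i) α) (avoids S α) ok))

  neighbours others : Fin m → List (Fin m) → List (Fin m)
  neighbours i = filter (shares? i)
  others     i = filter (∁? (shares? i))

  others-independent : ∀ i S {z} → z ∈ vars (A i) → IndependentOf z (avoids (others i S))
  others-independent i S z∈Ai = avoids-independent (others i S) λ j∈others z∈Aj →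
    proj₂ (∈-filter⁻ (∁? (shares? i)) {xs = S} j∈others) (lose z∈Ai z∈Aj)

  neighbours++others-unique : ∀ i {S} → Unique S → Unique (neighbours i S ++ others i S)
  neighbours++others-unique i {S} S-unique =
    Unique.++⁺ (Unique.filter⁺ (shares? i) S-unique) (Unique.filter⁺ (∁? (shares? i)) S-unique)
               λ (j∈nb , j∈ot) → proj₂ (∈-filter⁻ (∁? (shares? i)) {xs = S} j∈ot)
                                       (proj₂ (∈-filter⁻ (shares? i) {xs = S} j∈nb))

  length-neighbours++others : ∀ i S → length (neighbours i S ++ others i S) ≡ length S
  length-neighbours++others i S =
    trans (length-++ (neighbours i S)) (length-filter+length-filter-∁ (shares? i) S)

  ⊆-neighbours++others : ∀ i S → S ⊆ neighbours i S ++ others i S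
  ⊆-neighbours++others i S {j} j∈S with shares? i j
  ... | yes sh = ∈-++⁺ˡ (∈-filter⁺ (shares? i) j∈S sh)
  ... | no ¬sh = ∈-++⁺ʳ (neighbours i S) (∈-filter⁺ (∁? (shares? i)) j∈S ¬sh)

  module _ (c P D : ℕ) (1≤d : 1 ≤ d)
           (A⊆V : ∀ i → vars (A i) ⊆ V) (A-unique : ∀ i → Unique (vars (A i)))
           (P≤d^|A|*c : ∀ i → P ≤ d ^ length (A i) * c) (c<P : c < P)
           (lll-condition : suc D ^ suc D * c ≤ P * D ^ D)
           (few-neighbours : ∀ i S → Unique S → (∀ {j} → j ∈ S → j ≢ i × Shares i j) → length S ≤ D)
           where

    -- #violating i S / #avoiding S is the probability of violating A i given that S is avoided.
    Bounded : List (Fin m) → Set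
    Bounded S = ∀ i → suc D * #violating i S ≤ #avoiding S

    avoiding-chain : ∀ {n} → (∀ S → length S < n → Unique S → Bounded S) →
                     ∀ T U → Unique (T ++ U) → length (T ++ U) ≤ n →
                     D ^ length T * #avoiding U ≤ suc D ^ length T * #avoiding (T ++ U)
    avoiding-chain ih []      U _ _ = ≤-refl
    avoiding-chain ih (t ∷ T) U (_ ∷ T++U-unique) |T++U|<n = begin
      D * D ^ length T * #avoiding U                        ≡⟨ *-assoc D (D ^ length T) (#avoiding U) ⟩
      D * (D ^ length T * #avoiding U)                      ≤⟨ *-monoʳ-≤ D (avoiding-chain ih T U T++U-unique (<⇒≤ |T++U|<n)) ⟩
      D * (suc D ^ length T * #avoiding (T ++ U))           ≡⟨ x∙yz≈y∙xz D (suc D ^ length T) (#avoiding (T ++ U)) ⟩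
      suc D ^ length T * (D * #avoiding (T ++ U))           ≤⟨ *-monoʳ-≤ (suc D ^ length T) step ⟩
      suc D ^ length T * (suc D * #avoiding (t ∷ T ++ U))   ≡⟨ x∙yz≈y∙xz (suc D ^ length T) (suc D) _ ⟩
      suc D * (suc D ^ length T * #avoiding (t ∷ T ++ U))   ≡⟨ sym (*-assoc (suc D) (suc D ^ length T) _) ⟩
      suc D * suc D ^ length T * #avoiding (t ∷ T ++ U)     ∎
      where
      open ≤-Reasoning
      split = #avoiding-split t (T ++ U)
      step : D * #avoiding (T ++ U) ≤ suc D * #avoiding (t ∷ T ++ U)
      step = subst (λ z → D * z ≤ suc D * #avoiding (t ∷ T ++ U)) (sym split)
               (D*[z+w]≤[1+D]*z D _ _ (subst (suc D * #violating t (T ++ U) ≤_) split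
                 (ih (T ++ U) |T++U|<n T++U-unique t)))

    conditional-bound : ∀ S → (∀ S' → length S' < length S → Unique S' → Bounded S') → Unique S → ∀ i →
                        ∃[ s ] (s ≤ D × #violating i S * P * D ^ s ≤ suc D ^ s * c * #avoiding S)
    conditional-bound S ih S-unique i with any? (i ≟ᶠ_) S
    ... | yes i∈S = 0 , z≤n , subst (λ w → w * P * 1 ≤ 1 * c * #avoiding S) (sym (#violating-∈ i∈S)) z≤n
    ... | no  i∉S = s , s≤D , (begin
      #violating i S * P * D ^ s
        ≤⟨ *-monoˡ-≤ (D ^ s) (*-mono-≤ (#violating-antimono i {S₂} {S} (proj₁ ∘ ∈-filter⁻ (∁? (shares? i)) {xs = S}))
                                        (P≤d^|A|*c i)) ⟩
      #violating i S₂ * (d ^ length (A i) * c) * D ^ s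
        ≡⟨ rearrange (#violating i S₂) (d ^ length (A i)) c (D ^ s) ⟩
      D ^ s * (#violating i S₂ * d ^ length (A i)) * c
        ≡⟨ cong (λ z → D ^ s * z * c) (count-violating α₀ (A i) V _ (A⊆V i) (A-unique i) (others-independent i S)) ⟩
      D ^ s * #avoiding S₂ * c
        ≤⟨ *-monoˡ-≤ c (avoiding-chain ih S₁ S₂ (neighbours++others-unique i S-unique)
                                            (≤-reflexive (length-neighbours++others i S))) ⟩
      suc D ^ s * #avoiding (S₁ ++ S₂) * c
        ≤⟨ *-monoˡ-≤ c (*-monoʳ-≤ (suc D ^ s) (#avoiding-antimono (⊆-neighbours++others i S))) ⟩
      suc D ^ s * #avoiding S * c
        ≡⟨ xy∙z≈xz∙y (suc D ^ s) (#avoiding S) c ⟩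
      suc D ^ s * c * #avoiding S ∎)
      where
      open ≤-Reasoning
      S₁ = neighbours i S
      S₂ = others i S
      s = length S₁
      s≤D : s ≤ D
      s≤D = few-neighbours i S₁ (Unique.filter⁺ (shares? i) S-unique) λ j∈S₁ →
        let (j∈S , sh) = ∈-filter⁻ (shares? i) {xs = S} j∈S₁ in (λ j≡i → i∉S (subst (_∈ S) j≡i j∈S)) , sh
      rearrange : ∀ w x y z → w * (x * y) * z ≡ z * (w * x) * y
      rearrange = solve-∀

    shorter-bounded : ∀ n S → length S ≤ n → ∀ S' → length S' < length S → Unique S' → Bounded S'
    bounded : ∀ n S → length S ≤ n → Unique S → Bounded S

    shorter-bounded (suc n) S |S|≤1+n S' |S'|<|S| = bounded n S' (≤-pred (≤-trans |S'|<|S| |S|≤1+n))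
    shorter-bounded zero    S |S|≤0    S' |S'|<|S| = ⊥-elim (<⇒≱ (≤-trans |S'|<|S| |S|≤0) z≤n)

    bounded n S |S|≤n S-unique i with conditional-bound S (shorter-bounded n S |S|≤n) S-unique i
    ... | s , s≤D , bound = conditional-bound⇒[1+D]*w≤z c<P s≤D lll-condition bound

    #violating<#avoiding : ∀ {S} → Unique S → 0 < #avoiding S → ∀ i → #violating i S < #avoiding S
    #violating<#avoiding {S} S-unique Z>0 i
      with conditional-bound S (shorter-bounded (length S) S ≤-refl) S-unique i
    ... | s , s≤D , bound = conditional-bound⇒w<z c<P Z>0 s≤D lll-condition bound

    #avoiding-pos : ∀ S → Unique S → 0 < #avoiding S
    #avoiding-pos []      _                = count-all-pos α₀ 1≤d V
    #avoiding-pos (i ∷ S) (_ ∷ S-unique) = n<m+n⇒0<m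
      (subst (#violating i S <_) (#avoiding-split i S) (#violating<#avoiding S-unique (#avoiding-pos S S-unique) i))

    lovasz-local-lemma : ∃[ α ] (∀ i → satisfies (A i) α ≡ true)
    lovasz-local-lemma with count>0⇒∃ (avoids (allFin m)) (assignments α₀ V) (#avoiding-pos (allFin m) (Unique.allFin⁺ m))
    ... | α , all-ok = α , λ i → avoids-∈ α (∈-allFin i) all-ok

-- The reduced CSP

module Reduction {d k ℓ m : ℕ} (2≤d : 2 ≤ d) (2≤ℓ : 2 ≤ ℓ) (ℓ≤k : ℓ ≤ k)
                 (F : CSP k d m) (F-disjoint : Disjoint ℓ F)
                 (freq : List ℕ) (freq⇔frequent : ∀ x → (x ∈ freq) ⇔ Frequent ℓ F x)
                 (few-frequent : FewFrequent k d ℓ (length freq)) where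

  N c P : ℕ
  N = length freq
  c = d ^ (ℓ ∸ 1)
  P = d ^ k

  1+[ℓ∸1]≡ℓ : suc (ℓ ∸ 1) ≡ ℓ
  1+[ℓ∸1]≡ℓ = m+[n∸m]≡n (≤-trans (s≤s z≤n) 2≤ℓ)

  1≤k : 1 ≤ k
  1≤k = ≤-trans (s≤s z≤n) (≤-trans 2≤ℓ ℓ≤k)

  ℓ∸1<k : ℓ ∸ 1 < k
  ℓ∸1<k = subst (_≤ k) (sym 1+[ℓ∸1]≡ℓ) ℓ≤k

  literals : Fin m → List (Literal d)
  literals j = toList (lits (F j))

  variables : Fin m → List ℕ
  variables j = toList (vbl (lits (F j)))

  vars-literals : ∀ j → vars (literals j) ≡ variables j
  vars-literals j = sym (toList-map proj₁ (lits (F j)))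

  variables-unique : ∀ j → Unique (variables j)
  variables-unique j = toList-unique (vbl (lits (F j))) (distinct (F j))

  length-variables : ∀ j → length (variables j) ≡ k
  length-variables j = length-toList (vbl (lits (F j)))

  unique-⊆⇒≤common : ∀ j j' {L} → Unique L → L ⊆ variables j → L ⊆ variables j' → length L ≤ common (F j) (F j')
  unique-⊆⇒≤common j j' {L} L-unique L⊆j L⊆j' = begin
    length L                                        ≤⟨ unique-⊆⇒length-≤ L-unique L⊆shared ⟩
    length (map (lookup u) (filter shared? (allFin k))) ≡⟨ length-map (lookup u) (filter shared? (allFin k)) ⟩
    length (filter shared? (allFin k))              ≡⟨ sym (countFin≡length-filter shared?) ⟩
    common (F j) (F j')                             ∎
    where
    open ≤-Reasoning
    u = vbl (lits (F j))
    w = vbl (lits (F j'))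
    shared? : Decidable (λ i → lookup u i ∈ᵥ w)
    shared? i = lookup u i ∈ᵥ? w
    L⊆shared : L ⊆ map (lookup u) (filter shared? (allFin k))
    L⊆shared z∈L with ∈-toList⇒lookup u (L⊆j z∈L)
    ... | i , refl = ∈-map⁺ (lookup u) (∈-filter⁺ shared? (∈-allFin i) (VecAny.toList⁻ (L⊆j' z∈L)))

  frequent? : Decidable (_∈ freq)
  frequent? x = x ∈? freq

  #frequent : Fin m → ℕ
  #frequent j = length (filter frequent? (variables j))

  Kept : Fin m → ℕ → Set
  Kept j x = ℓ ≤ #frequent j ⊎ x ∉ freq

  kept? : ∀ j → Decidable (Kept j)
  kept? j x = (ℓ ≤? #frequent j) ⊎-dec ¬? (frequent? x)

  reduced : Fin m → List (Literal d)
  reduced j = filter (kept? j ∘ proj₁) (literals j)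

  vars-reduced : ∀ j → vars (reduced j) ≡ filter (kept? j) (variables j)
  vars-reduced j = trans (map-filter (kept? j) proj₁ (literals j)) (cong (filter (kept? j)) (vars-literals j))

  vars-reduced-unique : ∀ j → Unique (vars (reduced j))
  vars-reduced-unique j = subst Unique (sym (vars-reduced j)) (Unique.filter⁺ (kept? j) (variables-unique j))

  ∈-vars-reduced⁻ : ∀ {j y} → y ∈ vars (reduced j) → y ∈ variables j × Kept j y
  ∈-vars-reduced⁻ {j} {y} y∈ = ∈-filter⁻ (kept? j) {xs = variables j} (subst (y ∈_) (vars-reduced j) y∈)

  length-reduced : ∀ j → length (reduced j) ≡ length (filter (kept? j) (variables j))
  length-reduced j = trans (sym (length-map proj₁ (reduced j))) (cong length (vars-reduced j))

  length-reduced≤k : ∀ j → length (reduced j) ≤ k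
  length-reduced≤k j = begin
    length (reduced j)                        ≡⟨ length-reduced j ⟩
    length (filter (kept? j) (variables j))   ≤⟨ length-filter (kept? j) (variables j) ⟩
    length (variables j)                      ≡⟨ length-variables j ⟩
    k                                         ∎
    where open ≤-Reasoning

  k≤length-reduced+ℓ∸1 : ∀ j → k ≤ length (reduced j) + (ℓ ∸ 1)
  k≤length-reduced+ℓ∸1 j =
    subst (λ n → k ≤ n + (ℓ ∸ 1)) (sym (length-reduced j)) (by-cases (ℓ ≤? #frequent j))
    where
    open ≤-Reasoning
    kept = filter (kept? j) (variables j)
    nonfrequent⊆kept : filter (∁? frequent?) (variables j) ⊆ kept
    nonfrequent⊆kept x∈ = let (x∈j , x∉freq) = ∈-filter⁻ (∁? frequent?) {xs = variables j} x∈ in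
                          ∈-filter⁺ (kept? j) x∈j (inj₂ x∉freq)
    by-cases : Dec (ℓ ≤ #frequent j) → k ≤ length kept + (ℓ ∸ 1)
    by-cases (yes ℓ≤#freq) = begin
      k                        ≡⟨ sym (length-variables j) ⟩
      length (variables j)     ≤⟨ unique-⊆⇒length-≤ (variables-unique j) (λ x∈ → ∈-filter⁺ (kept? j) x∈ (inj₁ ℓ≤#freq)) ⟩
      length kept              ≤⟨ m≤m+n _ _ ⟩
      length kept + (ℓ ∸ 1)    ∎
    by-cases (no ℓ≰#freq) = begin
      k                                                           ≡⟨ sym (trans (length-filter+length-filter-∁ frequent? (variables j))
                                                                                (length-variables j)) ⟩
      #frequent j + length (filter (∁? frequent?) (variables j))  ≤⟨ +-mono-≤ #freq≤ℓ∸1 (unique-⊆⇒length-≤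
                                                                       (Unique.filter⁺ (∁? frequent?) (variables-unique j)) nonfrequent⊆kept) ⟩
      (ℓ ∸ 1) + length kept                                       ≡⟨ +-comm (ℓ ∸ 1) _ ⟩
      length kept + (ℓ ∸ 1)                                       ∎
      where
      #freq≤ℓ∸1 : #frequent j ≤ ℓ ∸ 1
      #freq≤ℓ∸1 = ≤-pred (subst (suc (#frequent j) ≤_) (sym 1+[ℓ∸1]≡ℓ) (≰⇒> ℓ≰#freq))

  frequent-in-reduced : ∀ {j y} → y ∈ vars (reduced j) → y ∈ freq → ℓ ≤ #frequent j
  frequent-in-reduced y∈ y∈freq with proj₂ (∈-vars-reduced⁻ y∈)
  ... | inj₁ ℓ≤#freq = ℓ≤#freq
  ... | inj₂ y∉freq  = ⊥-elim (y∉freq y∈freq)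

  satisfies-reduced⇒SatC : ∀ j α → satisfies (reduced j) α ≡ true → SatC α (F j)
  satisfies-reduced⇒SatC j α sat with satisfies⇒∃ (reduced j) α sat
  ... | lit , lit∈ , α≢lit
    with ∈-toList⇒lookup (lits (F j)) (proj₁ (∈-filter⁻ (kept? j ∘ proj₁) {xs = literals j} lit∈))
  ... | i , refl = i , α≢lit

  α₀ : Assignment d
  α₀ _ = Fin.fromℕ< 2≤d

  V : List ℕ
  V = concatMap (vars ∘ reduced) (allFin m)

  reduced⊆V : ∀ j → vars (reduced j) ⊆ V
  reduced⊆V j y∈ = ∈-concatMap⁺ (vars ∘ reduced) (lose (∈-allFin j) y∈)

  contains? : ∀ y → Decidable (λ j → y ∈ vars (reduced j))
  contains? y j = y ∈? vars (reduced j)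

  rdeg : ℕ → ℕ
  rdeg y = countFin (contains? y)

  rdeg≤deg : ∀ y → rdeg y ≤ deg y F
  rdeg≤deg y = countFin-mono (contains? y) (λ j → y ∈ᵥ? vbl (lits (F j)))
                             (VecAny.toList⁻ ∘ proj₁ ∘ ∈-vars-reduced⁻)

  module _ {y : ℕ} (y∈freq : y ∈ freq) where

    other? : Decidable (λ z → z ∈ freq × z ≢ y)
    other? z = frequent? z ×-dec ¬? (z ≟ y)

    other-frequent : Fin m → List ℕ
    other-frequent j = filter other? (variables j)

    witness : Fin m → List ℕ
    witness j = take (ℓ ∸ 1) (other-frequent j)

    ∈-witness⁻ : ∀ {j z} → z ∈ witness j → z ∈ variables j × z ∈ freq × z ≢ y
    ∈-witness⁻ {j} = ∈-filter⁻ other? {xs = variables j} ∘ ∈-take⁻ (ℓ ∸ 1) (other-frequent j)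

    y∷witness-unique : ∀ j → Unique (y ∷ witness j)
    y∷witness-unique j = All.tabulate (λ z∈ y≡z → proj₂ (proj₂ (∈-witness⁻ z∈)) (sym y≡z))
                         ∷ Unique.take⁺ (ℓ ∸ 1) (Unique.filter⁺ other? (variables-unique j))

    length-witness : ∀ {j} → y ∈ vars (reduced j) → length (witness j) ≡ ℓ ∸ 1
    length-witness {j} y∈ = trans (length-take (ℓ ∸ 1) (other-frequent j)) (m≤n⇒m⊓n≡m (≤-pred (begin
      suc (ℓ ∸ 1)               ≡⟨ 1+[ℓ∸1]≡ℓ ⟩
      ℓ                         ≤⟨ frequent-in-reduced y∈ y∈freq ⟩
      #frequent j               ≤⟨ unique-⊆⇒length-≤ (Unique.filter⁺ frequent? (variables-unique j)) frequent⊆y∷other-frequent ⟩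
      suc (length (other-frequent j)) ∎)))
      where
      open ≤-Reasoning
      frequent⊆y∷other-frequent : filter frequent? (variables j) ⊆ y ∷ other-frequent j
      frequent⊆y∷other-frequent {z} z∈ with z ≟ y
      ... | yes z≡y = here z≡y
      ... | no  z≢y = let (z∈j , z∈freq) = ∈-filter⁻ frequent? {xs = variables j} z∈ in
                      there (∈-filter⁺ other? z∈j (z∈freq , z≢y))

    -- Two constraints through y with equal witnesses would share the ℓ variables y ∷ witness.
    witness-injective : ∀ {j j'} → y ∈ vars (reduced j) → y ∈ vars (reduced j') → witness j ≡ witness j' → j ≡ j'
    witness-injective {j} {j'} y∈j y∈j' w≡w' with j ≟ᶠ j'
    ... | yes j≡j' = j≡j'
    ... | no  j≢j' = ⊥-elim (<⇒≱ (F-disjoint j j' j≢j') (begin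
      ℓ                           ≡⟨ sym (trans (cong suc (length-witness y∈j)) 1+[ℓ∸1]≡ℓ) ⟩
      length (y ∷ witness j)      ≤⟨ unique-⊆⇒≤common j j' (y∷witness-unique j) (⊆variables j y∈j)
                                       (λ {z} z∈ → ⊆variables j' y∈j' (subst (z ∈_) (cong (y ∷_) w≡w') z∈)) ⟩
      common (F j) (F j')         ∎))
      where
      open ≤-Reasoning
      ⊆variables : ∀ i → y ∈ vars (reduced i) → y ∷ witness i ⊆ variables i
      ⊆variables i y∈i (here refl)  = proj₁ (∈-vars-reduced⁻ y∈i)
      ⊆variables i y∈i (there z∈)   = proj₁ (∈-witness⁻ z∈)

    rdeg-frequent : rdeg y ≤ N ^ (ℓ ∸ 1)
    rdeg-frequent = begin
      rdeg y                          ≡⟨ countFin≡length-filter (contains? y) ⟩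
      length Js                       ≡⟨ sym (length-map witness Js) ⟩
      length (map witness Js)         ≤⟨ unique-⊆⇒length-≤ (map-unique (Unique.filter⁺ (contains? y) (Unique.allFin⁺ m))
                                           λ j∈ j'∈ → witness-injective (∈Js j∈) (∈Js j'∈)) witnesses⊆tuples ⟩
      length (tuples (ℓ ∸ 1) freq)    ≡⟨ length-tuples (ℓ ∸ 1) freq ⟩
      N ^ (ℓ ∸ 1)                     ∎
      where
      open ≤-Reasoning
      Js = filter (contains? y) (allFin m)
      ∈Js : ∀ {j} → j ∈ Js → y ∈ vars (reduced j)
      ∈Js = proj₂ ∘ ∈-filter⁻ (contains? y) {xs = allFin m}
      witnesses⊆tuples : map witness Js ⊆ tuples (ℓ ∸ 1) freq
      witnesses⊆tuples t∈ with ∈-map⁻ witness t∈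
      ... | j , j∈ , refl = subst (λ n → witness j ∈ tuples n freq) (length-witness (∈Js j∈))
                                  (∈-tuples (witness j) (proj₁ ∘ proj₂ ∘ ∈-witness⁻))

  rdeg·e≤P : ∀ y → rdeg y * c * k ·e≤ P
  rdeg·e≤P y with frequent? y
  ... | yes y∈freq = ≤-·e≤-trans {P} (*-monoˡ-≤ k (*-monoˡ-≤ c (rdeg-frequent y∈freq)))
                                 (e·≤⇒·e≤ {P} few-frequent)
  ... | no  y∉freq = ≤-·e≤-trans {P} (*-monoˡ-≤ k (*-monoˡ-≤ c (rdeg≤deg y)))
                                 (≮e·⇒·e≤ {P} (y∉freq ∘ Equivalence.from (freq⇔frequent y)))

  Δ : ℕ
  Δ = rdeg (argmax rdeg 0 V)

  rdeg≤Δ : ∀ {y} → y ∈ V → rdeg y ≤ Δ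
  rdeg≤Δ = All.lookup (f[xs]≤f[argmax] {f = rdeg} 0 V)

  open LocalLemma α₀ reduced V using (Shares; lovasz-local-lemma)

  others-through : Fin m → ℕ → List (Fin m)
  others-through i y = filter (λ j → contains? y j ×-dec ¬? (j ≟ᶠ i)) (allFin m)

  length-others-through : ∀ {i y} → y ∈ vars (reduced i) → length (others-through i y) ≤ Δ ∸ 1
  length-others-through {i} {y} y∈i =
    ∸-monoˡ-≤ 1 (≤-trans (unique-⊆⇒≤countFin (contains? y) i∷others-unique i∷others⊆) (rdeg≤Δ (reduced⊆V i y∈i)))
    where
    ∈others : ∀ {j} → j ∈ others-through i y → y ∈ vars (reduced j) × j ≢ i
    ∈others = proj₂ ∘ ∈-filter⁻ (λ j → contains? y j ×-dec ¬? (j ≟ᶠ i)) {xs = allFin m}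
    i∷others-unique : Unique (i ∷ others-through i y)
    i∷others-unique = All.tabulate (λ j∈ i≡j → proj₂ (∈others j∈) (sym i≡j)) ∷ Unique.filter⁺ _ (Unique.allFin⁺ m)
    i∷others⊆ : ∀ {j} → j ∈ i ∷ others-through i y → y ∈ vars (reduced j)
    i∷others⊆ (here refl) = y∈i
    i∷others⊆ (there j∈)  = proj₁ (∈others j∈)

  few-neighbours : ∀ i S → Unique S → (∀ {j} → j ∈ S → j ≢ i × Shares i j) → length S ≤ k * Δ ∸ 1
  few-neighbours i S S-unique S-neighbours = begin
    length S                                                  ≤⟨ unique-⊆⇒length-≤ S-unique S⊆ ⟩
    length (concatMap (others-through i) (vars (reduced i))) ≤⟨ length-concatMap-≤ _ _ length-others-through ⟩
    length (vars (reduced i)) * (Δ ∸ 1)                       ≤⟨ *-monoˡ-≤ (Δ ∸ 1) (≤-trans (≤-reflexive (length-map proj₁ (reduced i)))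
                                                                                             (length-reduced≤k i)) ⟩
    k * (Δ ∸ 1)                                               ≡⟨ *-distribˡ-∸ k Δ 1 ⟩
    k * Δ ∸ k * 1                                             ≤⟨ ∸-monoʳ-≤ (k * Δ) (≤-trans 1≤k (≤-reflexive (sym (*-identityʳ k)))) ⟩
    k * Δ ∸ 1                                                 ∎
    where
    open ≤-Reasoning
    S⊆ : S ⊆ concatMap (others-through i) (vars (reduced i))
    S⊆ {j} j∈S = let (j≢i , shares) = S-neighbours j∈S in
      ∈-concatMap⁺ (others-through i) (Any.map (λ y∈j → ∈-filter⁺ _ (∈-allFin j) (y∈j , j≢i)) shares)

  1≤d : 1 ≤ d
  1≤d = ≤-trans (s≤s z≤n) 2≤d

  c<P : c < P
  c<P = ^-monoʳ-< d 2≤d ℓ∸1<k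

  P≤d^|reduced|*c : ∀ j → P ≤ d ^ length (reduced j) * c
  P≤d^|reduced|*c j = ≤-trans (^-monoʳ-≤ d {{>-nonZero 1≤d}} (k≤length-reduced+ℓ∸1 j))
                              (≤-reflexive (^-distribˡ-+-* d (length (reduced j)) (ℓ ∸ 1)))

  reduced-nonempty : ∀ j → 0 < length (vars (reduced j))
  reduced-nonempty j = subst (0 <_) (sym (length-map proj₁ (reduced j)))
                             (+-cancelʳ-< (ℓ ∸ 1) 0 _ (<-≤-trans ℓ∸1<k (k≤length-reduced+ℓ∸1 j)))

  rdeg≥1 : ∀ {j y} → y ∈ vars (reduced j) → 1 ≤ rdeg y
  rdeg≥1 {j} {y} y∈j = unique-⊆⇒≤countFin (contains? y) {L = [ j ]} ([] ∷ []) λ { (here refl) → y∈j }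

  Δ≥1 : Fin m → 1 ≤ Δ
  Δ≥1 j₀ = ≤-trans (rdeg≥1 y₀∈) (rdeg≤Δ (reduced⊆V j₀ y₀∈))
    where
    y₀∈ = proj₂ (nonempty⇒∃ (vars (reduced j₀)) (reduced-nonempty j₀))

  satisfiable : Fin m → Satisfiable F
  satisfiable j₀ = α , λ j → satisfies-reduced⇒SatC j α (α-ok j)
    where
    D = k * Δ ∸ 1
    [1+D]*c≡Δ*c*k : suc D * c ≡ Δ * c * k
    [1+D]*c≡Δ*c*k = trans (cong (_* c) (m+[n∸m]≡n (*-mono-≤ 1≤k (Δ≥1 j₀)))) (xy∙z≈yz∙x k Δ c)
    lll-condition : suc D ^ suc D * c ≤ P * D ^ D
    lll-condition = ·e≤⇒[1+D]^[1+D]*c≤P*D^D {P} D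
                      (≤-·e≤-trans {P} (≤-reflexive [1+D]*c≡Δ*c*k) (rdeg·e≤P (argmax rdeg 0 V)))
    lll = lovasz-local-lemma c P D 1≤d reduced⊆V vars-reduced-unique P≤d^|reduced|*c c<P lll-condition few-neighbours
    α = proj₁ lll
    α-ok = proj₂ lll

theorem2 : (d k ℓ m : ℕ) → 2 ≤ d → 2 ≤ ℓ → ℓ ≤ k →
    (F : CSP k d m) → Disjoint ℓ F →
    (freq : List ℕ) → Unique freq → (∀ x → (x ∈ freq) ⇔ Frequent ℓ F x) →
    FewFrequent k d ℓ (length freq) →
    Satisfiable F
theorem2 d k ℓ zero    2≤d _   _   F _ _ _ _ _ = (λ _ → Fin.fromℕ< 2≤d) , λ ()
theorem2 d k ℓ (suc m) 2≤d 2≤ℓ ℓ≤k F F-disjoint freq _ freq⇔frequent few-frequent =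
  Reduction.satisfiable 2≤d 2≤ℓ ℓ≤k F F-disjoint freq freq⇔frequent few-frequent zero
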